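{- Let $S = (s_0, \ldots, s_{k-1})$ be any finite (possibly empty) sequence of positive integers, and let $y \geq 2$ and $x \geq 1$ be integers. Let $G$ be the \textsc{Tower Nim} position $(s_0, \ldots, s_{k-1}, y, x)$. If $x = 1$, then $G = 0$, i.e. $G \in \mathcal{P}$; if $x \geq 2$, then $G \in \mathcal{N}$.
   Context: \textsc{Tower Nim} is an impartial combinatorial game played under normal play (a player unable to move loses). A position is a finite list $L = (a_0, a_1, \ldots, a_n)$ of positive integers (a stack of heaps; $a_n$ is the top heap); the empty list is the terminal position. The options of $L$ are: $(a_0, \ldots, a_{n-1})$ (remove the whole top heap), and $(a_0, \ldots, a_{n-1}, b)$ for every integer $b$ with $1 \leq b < a_n$. $\mathcal{N}$ denotes the positions from which the next player to move wins, $\mathcal{P}$ those from which the previous player wins; $G=0$ means Grundy value $0$. -}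

module Defs where

open import Data.Nat using (ℕ; _<_; _≤_)
open import Data.List using (List; []; _∷_; _∷ʳ_)
open import Data.Product using (Σ; _×_)

-- A Tower Nim position: a list (a₀, …, aₙ) of positive integers, written
-- left to right with the LAST element aₙ being the top heap.
-- The empty list is the terminal position.

data Move : List ℕ → List ℕ → Set where
  removeTop : ∀ (L : List ℕ) (a : ℕ) → Move (L ∷ʳ a) L
  reduceTop : ∀ (L : List ℕ) (a b : ℕ) → 1 ≤ b → b < a → Move (L ∷ʳ a) (L ∷ʳ b)

data IsN : List ℕ → Set
data IsP : List ℕ → Set

data IsN where
  winMove : ∀ {L L'} → Move L L' → IsP L' → IsN L

data IsP where
  allLose : ∀ {L} → (∀ L' → Move L L' → IsN L') → IsP L

-- A position whose top heap is 1 has the position below it as its only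
-- option, so it is P exactly when that position is N. A top heap a ≥ 2 is
-- always a win: remove it if the position below is P, otherwise reduce it to
-- 1, which is then P. By induction every position is N or P; so (S, y) is N,
-- (S, y, 1) is P, and (S, y, x) with x ≥ 2 is N since it can move to (S, y, 1).
module Submission where

open import Defs
open import Data.Nat using (ℕ; _≤_; _<_; _≤?_)
open import Data.Nat.Properties using (≤-refl; ≤-trans; ≤⇒≯; ≰⇒>)
open import Data.List using (List; []; _∷_; _∷ʳ_)
open import Data.List.Properties using (∷ʳ-injective)
open import Data.List.Reverse using (Reverse; []; _∶_∶ʳ_; reverseView)
open import Data.List.Relation.Unary.All using (All)
open import Data.Product using (_×_; _,_)
open import Data.Sum using (_⊎_; inj₁; inj₂)
open import Data.Empty using (⊥-elim)
open import Relation.Nullary using (yes; no)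
open import Relation.Binary.PropositionalEquality using (_≡_; _≢_; refl)

data Option (L : List ℕ) (a : ℕ) : List ℕ → Set where
  removed : Option L a L
  reduced : ∀ b → 1 ≤ b → b < a → Option L a (L ∷ʳ b)

-- Matching on a Move whose source is L ∷ʳ a gets stuck on ∷ʳ, so the source
-- is generalised and the equation inverted with ∷ʳ-injective.
move⇒option : ∀ {K L'} → Move K L' → ∀ L a → K ≡ L ∷ʳ a → Option L a L'
move⇒option (removeTop L₁ a₁) L a eq with ∷ʳ-injective L₁ L eq
... | refl , refl = removed
move⇒option (reduceTop L₁ a₁ b 1≤b b<a₁) L a eq with ∷ʳ-injective L₁ L eq
... | refl , refl = reduced b 1≤b b<a₁

move-∷ʳ : ∀ {L a L'} → Move (L ∷ʳ a) L' → Option L a L'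
move-∷ʳ {L} {a} m = move⇒option m L a refl

∷ʳ≢[] : ∀ (L : List ℕ) a → L ∷ʳ a ≢ []
∷ʳ≢[] [] _ ()
∷ʳ≢[] (_ ∷ _) _ ()

[]-isP : IsP []
[]-isP = allLose λ _ m → ⊥-elim (noMove m refl)
  where
  noMove : ∀ {K L'} → Move K L' → K ≢ []
  noMove (removeTop L a) = ∷ʳ≢[] L a
  noMove (reduceTop L a _ _ _) = ∷ʳ≢[] L a

Determined : List ℕ → Set
Determined L = IsN L ⊎ IsP L

isN⇒isP-∷ʳ : ∀ {L a} → a ≤ 1 → IsN L → IsP (L ∷ʳ a)
isN⇒isP-∷ʳ {L} {a} a≤1 nL = allLose λ _ m → option-isN (move-∷ʳ m)
  where
  option-isN : ∀ {L'} → Option L a L' → IsN L'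
  option-isN removed = nL
  option-isN (reduced b 1≤b b<a) = ⊥-elim (≤⇒≯ 1≤b (≤-trans b<a a≤1))

isP⇒isN-∷ʳ : ∀ {L} a → IsP L → IsN (L ∷ʳ a)
isP⇒isN-∷ʳ {L} a pL = winMove (removeTop L a) pL

isN-∷ʳ : ∀ {L a} → 2 ≤ a → Determined L → IsN (L ∷ʳ a)
isN-∷ʳ {L} {a} 2≤a (inj₁ nL) = winMove (reduceTop L a 1 ≤-refl 2≤a) (isN⇒isP-∷ʳ ≤-refl nL)
isN-∷ʳ {L} {a} _   (inj₂ pL) = isP⇒isN-∷ʳ a pL

determined-∷ʳ : ∀ {L} a → Determined L → Determined (L ∷ʳ a)
determined-∷ʳ a dL with a ≤? 1
determined-∷ʳ a (inj₁ nL) | yes a≤1 = inj₂ (isN⇒isP-∷ʳ a≤1 nL)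
determined-∷ʳ a (inj₂ pL) | yes _   = inj₁ (isP⇒isN-∷ʳ a pL)
determined-∷ʳ a dL        | no a≰1  = inj₁ (isN-∷ʳ (≰⇒> a≰1) dL)

determined : ∀ L → Determined L
determined L = go (reverseView L)
  where
  go : ∀ {L} → Reverse L → Determined L
  go []            = inj₂ []-isP
  go (_ ∶ r ∶ʳ a) = determined-∷ʳ a (go r)

mainTheorem3 : ∀ (S : List ℕ) (y x : ℕ) → All (1 ≤_) S → 2 ≤ y → 1 ≤ x →
    (x ≡ 1 → IsP (S ∷ʳ y ∷ʳ x)) × (2 ≤ x → IsN (S ∷ʳ y ∷ʳ x))
mainTheorem3 S y x _ 2≤y _ = (λ { refl → Sy1-isP }) , (λ 2≤x → isN-∷ʳ 2≤x (inj₁ Sy-isN))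
  where
  Sy-isN : IsN (S ∷ʳ y)
  Sy-isN = isN-∷ʳ 2≤y (determined S)

  Sy1-isP : IsP (S ∷ʳ y ∷ʳ 1)
  Sy1-isP = isN⇒isP-∷ʳ ≤-refl Sy-isN
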